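{- Let $n\ge 1$ and let $x_1,\dots,x_n$ be distinct integers greater than $1$, and let $D=\{1,x_1,\dots,x_n\}$. Then $diam(D)=2$ if $n=1$, $diam(D)=3$ if $n=2$, and $diam(D)=4$ if $n>2$.
   Context: A signed tree is a pair $(T,s)$ with $T$ a finite tree and $s:E(T)\to\{+,-\}$. The signed degree $sdeg(v)$ of a vertex is the number of incident positive edges minus the number of incident negative edges. $(T,s)$ realizes (satisfies) $D$ if $D=\{sdeg(v):v\in V(T)\}$. For a set $D$ of integers containing $1$ or $-1$, $diam(D)$ is the minimum of $diam(T)$ over all signed trees $(T,s)$ that realize $D$. -}

module Defs where

open import Data.Nat using (ℕ; zero; suc; _≤_; _<_)
open import Data.Fin using (Fin; zero; suc; inject₁; fromℕ)
open import Data.Integer using (ℤ; +_; -_; _+_)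
open import Data.Maybe using (Maybe; just; nothing)
open import Data.Product using (Σ; ∃; ∃-syntax; _×_; _,_)
open import Relation.Binary.PropositionalEquality using (_≡_)
open import Function.Definitions using (Injective)
open import Data.Empty using (⊥)
open import Data.Sum using (_⊎_)

data Sign : Set where
  pos neg : Sign

-- A finite simple graph with signed edges on vertex set Fin m:
-- edge i j ≡ nothing  means no edge between i and j,
-- edge i j ≡ just s   means an edge between i and j with sign s.
record SignedGraph (m : ℕ) : Set where
  field
    edge  : Fin m → Fin m → Maybe Sign
    symm  : ∀ i j → edge i j ≡ edge j i
    irrefl : ∀ i → edge i i ≡ nothing

open SignedGraph public

Adj : ∀ {m} → SignedGraph m → Fin m → Fin m → Set
Adj G i j = Σ Sign (λ s → edge G i j ≡ just s)

data Walk {m} (G : SignedGraph m) : Fin m → Fin m → ℕ → Set where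
  here : ∀ {u} → Walk G u u 0
  step : ∀ {u w v k} → Adj G u w → Walk G w v k → Walk G u v (suc k)

Connected : ∀ {m} → SignedGraph m → Set
Connected G = ∀ u v → ∃[ k ] Walk G u v k

-- a cycle: pairwise distinct vertices c 0, …, c (j+2) (at least 3 of them),
-- consecutive ones adjacent and the last adjacent to the first
Cycle : ∀ {m} → SignedGraph m → Set
Cycle {m} G =
  ∃[ j ] Σ (Fin (suc (suc (suc j))) → Fin m) λ c →
    Injective _≡_ _≡_ c
    × (∀ (i : Fin (suc (suc j))) → Adj G (c (inject₁ i)) (c (suc i)))
    × Adj G (c (fromℕ (suc (suc j)))) (c zero)

Acyclic : ∀ {m} → SignedGraph m → Set
Acyclic G = Cycle G → ⊥

record SignedTree : Set where
  field
    size      : ℕ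
    graph     : SignedGraph (suc size)
    connected : Connected graph
    acyclic   : Acyclic graph

open SignedTree public

contrib : Maybe Sign → ℤ
contrib nothing         = + 0
contrib (just pos)      = + 1
contrib (just neg)      = - (+ 1)

sumFin : ∀ {m} → (Fin m → ℤ) → ℤ
sumFin {zero}  f = + 0
sumFin {suc m} f = f zero + sumFin (λ i → f (suc i))

sdeg : (T : SignedTree) → Fin (suc (size T)) → ℤ
sdeg T v = sumFin (λ w → contrib (edge (graph T) v w))

Realizes : SignedTree → (ℤ → Set) → Set
Realizes T D =
  (∀ v → D (sdeg T v)) × (∀ z → D z → ∃[ v ] sdeg T v ≡ z)

DistLe : (T : SignedTree) → Fin (suc (size T)) → Fin (suc (size T)) → ℕ → Set
DistLe T u v d = ∃[ k ] (k ≤ d × Walk (graph T) u v k)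

HasDiam : SignedTree → ℕ → Set
HasDiam T d =
  (∀ u v → DistLe T u v d)
  × (∃[ u ] ∃[ v ] (∀ k → Walk (graph T) u v k → d ≤ k))

DiamSet : (ℤ → Set) → ℕ → Set
DiamSet D d =
  (∃[ T ] (Realizes T D × HasDiam T d))
  × (∀ T d′ → Realizes T D → HasDiam T d′ → d ≤ d′)

DSet : ∀ {n} → (Fin n → ℤ) → ℤ → Set
DSet {n} x z = (z ≡ + 1) ⊎ (∃[ i ] z ≡ x i)

{-# OPTIONS --safe #-}
module Submission where

-- Lower bound: a vertex of signed degree x ≥ 2 has two distinct neighbours.  In a tree a
-- non-backtracking walk is the unique, hence shortest, walk between its ends, and a
-- non-backtracking walk whose two ends have two neighbours each can be prolonged by one edge
-- at both ends.  So one such vertex forces diameter 2, two force the path between them plus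
-- two edges (≥ 3), and of three such vertices either two are at distance ≥ 2, or one is
-- adjacent to the other two and the path through it gives 4.
-- Upper bound: a root with children, each inner vertex carrying pendant positive leaves —
-- a star, a double star, and for n ≥ 3 a root with n negative edges — realizes D with
-- diameter 2, 3 and 4 respectively.

open import Defs
open import Data.Bool using (if_then_else_)
open import Data.Empty using (⊥-elim)
open import Data.Fin using (Fin; zero; suc; inject₁; fromℕ; splitAt; join; _↑ˡ_; _↑ʳ_)
open import Data.Fin.Properties
  using (_≟_; 0≢1+n; suc-injective; splitAt-↑ˡ; splitAt-↑ʳ; splitAt-join; join-splitAt)
open import Data.Fin.Relation.Unary.Top using (view; ‵fromℕ; ‵inject₁)
open import Data.Integer using (ℤ; +_; -_; -[1+_]; _⊖_; +≤+; -≤+; +<+)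
  renaming (_+_ to _+ℤ_; _≤_ to _≤ℤ_; _<_ to _<ℤ_)
open import Data.Integer.Properties
  using (i<j⇒suc[i]≤j; pred-mono; pred-suc; +-monoˡ-≤; m-n≡m⊖n; ⊖-≥)
  renaming ( ≤-trans to ≤ℤ-trans; +-identityˡ to +ℤ-identityˡ; +-identityʳ to +ℤ-identityʳ
           ; +-assoc to +ℤ-assoc; +-comm to +ℤ-comm)
open import Data.List using (List; []; _∷_; _++_; [_]; length; lookup; reverse; _ʳ++_)
open import Data.List.Membership.Propositional using (_∈_; _∉_)
open import Data.List.Membership.Propositional.Properties using (∈-lookup; ∈-∃++; ∈-++⁺ʳ)
open import Data.List.Properties using (length-++; ʳ++-defn)
open import Data.List.Relation.Unary.All as All using ([]; _∷_)
open import Data.List.Relation.Unary.All.Properties using (¬Any⇒All¬; ++⁻ˡ)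
open import Data.List.Relation.Unary.Any using (here; there)
open import Data.List.Relation.Unary.Any.Properties using (reverse⁺)
open import Data.List.Relation.Unary.Unique.Propositional using (Unique; []; _∷_)
open import Data.List.Relation.Unary.Unique.Propositional.Properties using (Unique[x∷xs]⇒x∉xs)
open import Data.Maybe using (Maybe; just; nothing)
open import Data.Nat using (ℕ; zero; suc; _≤_; _<_; _∸_; z≤n; s≤s) renaming (_+_ to _+ℕ_)
open import Data.Nat.Properties
  using (≤-trans; ≤-refl; +-comm; +-mono-≤; +-monoʳ-≤; m<n⇒m≤1+n; n≤1+n; m+n∸n≡m)
open import Data.Product using (∃-syntax; _×_; _,_; proj₁; proj₂; map)
open import Data.Sum using (_⊎_; inj₁; inj₂; [_,_]′)
open import Data.Unit using (⊤; tt)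
open import Function using (_∘_; id)
open import Function.Definitions using (Injective)
open import Relation.Nullary using (yes; no; does)
open import Relation.Binary.PropositionalEquality
  using (_≡_; _≢_; refl; sym; trans; cong; cong₂; subst; subst₂; module ≡-Reasoning)
open ≡-Reasoning

module _ {a} {A : Set a} where

  end : A → List A → A
  end x []       = x
  end _ (y ∷ ys) = end y ys

  end∈ : ∀ x ys → end x ys ∈ x ∷ ys
  end∈ x []       = here refl
  end∈ x (y ∷ ys) = there (end∈ y ys)

  end-++ : ∀ x ys z → end x (ys ++ [ z ]) ≡ z
  end-++ x []       z = refl
  end-++ x (y ∷ ys) z = end-++ y ys z

  lookup-end : ∀ x xs → lookup (x ∷ xs) (fromℕ (length xs)) ≡ end x xs
  lookup-end x []       = refl
  lookup-end x (y ∷ ys) = lookup-end y ys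

  lookup-injective : ∀ {xs : List A} → Unique xs → ∀ i j → lookup xs i ≡ lookup xs j → i ≡ j
  lookup-injective (_ ∷ _)  zero    zero    _ = refl
  lookup-injective (x≢ ∷ _) zero    (suc j) e = ⊥-elim (All.lookup x≢ (∈-lookup j) e)
  lookup-injective (x≢ ∷ _) (suc i) zero    e = ⊥-elim (All.lookup x≢ (∈-lookup i) (sym e))
  lookup-injective (_ ∷ u)  (suc i) (suc j) e = cong suc (lookup-injective u i j e)

  unique-prefix : ∀ (zs : List A) {x rest} → Unique (zs ++ x ∷ rest) → Unique (x ∷ zs)
  unique-prefix []       _ = [] ∷ []
  unique-prefix (z ∷ zs) (z≢ ∷ u) with unique-prefix zs u
  ... | x≢ ∷ uzs = (All.lookup z≢ (∈-++⁺ʳ zs (here refl)) ∘ sym ∷ x≢) ∷ ++⁻ˡ zs z≢ ∷ uzs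

  unique-++⇒∉ : ∀ (xs : List A) {ys v} → Unique (xs ++ ys) → v ∈ xs → v ∉ ys
  unique-++⇒∉ (x ∷ xs) (x≢ ∷ _) (here refl) v∈ys = All.lookup x≢ (∈-++⁺ʳ xs v∈ys) refl
  unique-++⇒∉ (x ∷ xs) (_ ∷ u)  (there v∈xs)    = unique-++⇒∉ xs u v∈xs

inject₁²≢suc² : ∀ {n} (i : Fin n) → inject₁ (inject₁ i) ≢ suc (suc i)
inject₁²≢suc² zero    ()
inject₁²≢suc² (suc i) = inject₁²≢suc² i ∘ suc-injective

-- Walks in signed graphs

module Paths {m : ℕ} (G : SignedGraph m) where

  Vertex : Set
  Vertex = Fin m

  open import Data.List.Membership.DecPropositional (_≟_ {m}) using (_∈?_)

  adj-sym : ∀ {u w} → Adj G u w → Adj G w u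
  adj-sym {u} {w} (s , e) = s , trans (symm G w u) e

  adj⇒≢ : ∀ {u w} → Adj G u w → u ≢ w
  adj⇒≢ {u} (s , e) refl with trans (sym e) (irrefl G u)
  ... | ()

  _++ʷ_ : ∀ {u w v k l} → Walk G u w k → Walk G w v l → Walk G u v (k +ℕ l)
  here     ++ʷ W = W
  step a V ++ʷ W = step a (V ++ʷ W)

  snocʷ : ∀ {u v w k} → Walk G u v k → Adj G v w → Walk G u w (suc k)
  snocʷ here       a = step a here
  snocʷ (step b W) a = step b (snocʷ W a)

  reverseʷ : ∀ {u v k} → Walk G u v k → Walk G v u k
  reverseʷ here       = here
  reverseʷ (step a W) = snocʷ (reverseʷ W) (adj-sym a)

  DistantPair : ℕ → Set
  DistantPair d = ∃[ u ] ∃[ v ] (∀ k → Walk G u v k → d ≤ k)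

  distantPair-weaken : ∀ {d d′} → d ≤ d′ → DistantPair d′ → DistantPair d
  distantPair-weaken d≤d′ (u , v , far) = u , v , λ k W → ≤-trans d≤d′ (far k W)

  cycle-neighbours : ∀ {j} (c : Fin (suc (suc (suc j))) → Vertex) →
                     (∀ (i : Fin (suc (suc j))) → Adj G (c (inject₁ i)) (c (suc i))) →
                     Adj G (c (fromℕ (suc (suc j)))) (c zero) →
                     ∀ k → ∃[ k₁ ] ∃[ k₂ ] k₁ ≢ k₂ × Adj G (c k) (c k₁) × Adj G (c k) (c k₂)
  cycle-neighbours c chain close zero = suc zero , fromℕ _ , (λ ()) , chain zero , adj-sym close
  cycle-neighbours c chain close (suc k) with view k
  ... | ‵fromℕ     = inject₁ (fromℕ _) , zero , (λ ()) , adj-sym (chain (fromℕ _)) , close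
  ... | ‵inject₁ i = inject₁ (inject₁ i) , suc (suc i) , inject₁²≢suc² i ,
                     adj-sym (chain (inject₁ i)) , chain (suc i)

  NoReturn : Vertex → List Vertex → Set
  NoReturn x []          = ⊤
  NoReturn x (_ ∷ [])    = ⊤
  NoReturn x (_ ∷ z ∷ _) = x ≢ z

  data NonBacktracking : List Vertex → Set where
    single : ∀ x → NonBacktracking [ x ]
    cons   : ∀ {x y ys} → Adj G x y → NoReturn x (y ∷ ys) → NonBacktracking (y ∷ ys) →
             NonBacktracking (x ∷ y ∷ ys)

  nb-tail : ∀ {x y ys} → NonBacktracking (x ∷ y ∷ ys) → NonBacktracking (y ∷ ys)
  nb-tail (cons _ _ P) = P

  shortcut : ∀ {u v k} → Walk G u v k →
             ∃[ ys ] NonBacktracking (u ∷ ys) × end u ys ≡ v × length ys ≤ k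
  shortcut here = [] , single _ , refl , z≤n
  shortcut (step {u} {w} a W) with shortcut W
  ... | [] , P , e , l = [ w ] , cons a tt P , e , s≤s z≤n
  ... | y ∷ ys , P , e , l with y ≟ u
  ... | yes refl = ys , nb-tail P , e , m<n⇒m≤1+n l
  ... | no y≢u   = w ∷ y ∷ ys , cons a (y≢u ∘ sym) P , e , s≤s l

  nb-lookup : ∀ {x xs} → NonBacktracking (x ∷ xs) → ∀ (i : Fin (length xs)) →
              Adj G (lookup (x ∷ xs) (inject₁ i)) (lookup (x ∷ xs) (suc i))
  nb-lookup (cons a _ _) zero    = a
  nb-lookup (cons _ _ P) (suc i) = nb-lookup P i

  nb-prefix : ∀ x zs ys → NonBacktracking (x ∷ zs ++ ys) → NonBacktracking (x ∷ zs)
  nb-prefix x []           ys _             = single x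
  nb-prefix x (z ∷ [])     ys (cons a _ _)  = cons a tt (single z)
  nb-prefix x (z ∷ y ∷ zs) ys (cons a nr P) = cons a nr (nb-prefix z (y ∷ zs) ys P)

  nb-join : ∀ x zs y ys → NonBacktracking (x ∷ zs ++ y ∷ ys) → Adj G (end x zs) y
  nb-join x []       y ys (cons a _ _) = a
  nb-join x (z ∷ zs) y ys (cons _ _ P) = nb-join z zs y ys P

  closed⇒cycle : ∀ {x y z zs} → NonBacktracking (x ∷ y ∷ z ∷ zs) → Unique (x ∷ y ∷ z ∷ zs) →
                 Adj G (end z zs) x → Cycle G
  closed⇒cycle {x} {y} {z} {zs} P u a =
    length zs , lookup (x ∷ y ∷ z ∷ zs) , (λ {i} {j} → lookup-injective u i j) , nb-lookup P ,
    subst (λ v → Adj G v x) (sym (lookup-end x (y ∷ z ∷ zs))) a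

  return⇒cycle : ∀ x zs rest → NonBacktracking (x ∷ zs ++ x ∷ rest) → Unique (zs ++ x ∷ rest) →
                 Cycle G
  return⇒cycle x []           rest (cons a _ _)  _ = ⊥-elim (adj⇒≢ a refl)
  return⇒cycle x (_ ∷ [])     rest (cons _ nr _) _ = ⊥-elim (nr refl)
  return⇒cycle x (y ∷ z ∷ zs) rest P u =
    closed⇒cycle (nb-prefix x (y ∷ z ∷ zs) (x ∷ rest) P) (unique-prefix (y ∷ z ∷ zs) u)
                 (nb-join x (y ∷ z ∷ zs) x rest P)

  nb⇒unique⊎cycle : ∀ {xs : List Vertex} → NonBacktracking xs → Unique xs ⊎ Cycle G
  nb⇒unique⊎cycle (single x) = inj₁ ([] ∷ [])
  nb⇒unique⊎cycle {x ∷ ys} P@(cons _ _ Q) with nb⇒unique⊎cycle Q | x ∈? ys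
  ... | inj₂ c | _        = inj₂ c
  ... | inj₁ u | no x∉ys  = inj₁ (¬Any⇒All¬ ys x∉ys ∷ u)
  ... | inj₁ u | yes x∈ys with ∈-∃++ x∈ys
  ... | zs , rest , ys≡ =
    inj₂ (return⇒cycle x zs rest (subst (NonBacktracking ∘ (x ∷_)) ys≡ P) (subst Unique ys≡ u))

  acyclic⇒unique : Acyclic G → ∀ {xs : List Vertex} → NonBacktracking xs → Unique xs
  acyclic⇒unique ac P = [ id , ⊥-elim ∘ ac ]′ (nb⇒unique⊎cycle P)

  Diverge : List Vertex → List Vertex → Set
  Diverge []      _       = ⊤
  Diverge (_ ∷ _) []      = ⊤
  Diverge (z ∷ _) (a ∷ _) = z ≢ a

  nb-glue : ∀ {h} zs acc → NonBacktracking (h ∷ zs) → NonBacktracking (h ∷ acc) → Diverge zs acc →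
            NonBacktracking (zs ʳ++ h ∷ acc)
  nb-glue []       acc _             Q _   = Q
  nb-glue (z ∷ zs) acc (cons a nr P) Q div =
    nb-glue zs (_ ∷ acc) P (cons (adj-sym a) (no-return acc div) Q) (diverge zs nr)
    where
      no-return : ∀ acc → Diverge (z ∷ zs) acc → NoReturn z (_ ∷ acc)
      no-return []      _   = tt
      no-return (_ ∷ _) z≢a = z≢a
      diverge : ∀ zs → NoReturn _ (z ∷ zs) → Diverge zs (_ ∷ acc)
      diverge []      _   = tt
      diverge (_ ∷ _) h≢y = h≢y ∘ sym

  module _ (ac : Acyclic G) where

    -- If the walks leave x along different edges, reversing one and appending the other
    -- gives a non-backtracking walk through their common end twice.
    nb-length-unique : ∀ x ps qs → NonBacktracking (x ∷ ps) → NonBacktracking (x ∷ qs) →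
                       end x ps ≡ end x qs → length ps ≡ length qs
    nb-length-unique x []       []       _ _ _ = refl
    nb-length-unique x []       (q ∷ qs) _ Q e =
      ⊥-elim (Unique[x∷xs]⇒x∉xs (acyclic⇒unique ac Q) (subst (_∈ q ∷ qs) (sym e) (end∈ q qs)))
    nb-length-unique x (p ∷ ps) []       P _ e =
      ⊥-elim (Unique[x∷xs]⇒x∉xs (acyclic⇒unique ac P) (subst (_∈ p ∷ ps) e (end∈ p ps)))
    nb-length-unique x (p ∷ ps) (q ∷ qs) P Q e with p ≟ q
    ... | yes refl = cong suc (nb-length-unique p ps qs (nb-tail P) (nb-tail Q) e)
    ... | no p≢q   = ⊥-elim (unique-++⇒∉ (reverse (p ∷ ps)) glued-unique (reverse⁺ (end∈ p ps))
                                         (subst (_∈ x ∷ q ∷ qs) (sym e) (there (end∈ q qs))))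
      where
        glued-unique : Unique (reverse (p ∷ ps) ++ x ∷ q ∷ qs)
        glued-unique = subst Unique (ʳ++-defn (p ∷ ps))
                             (acyclic⇒unique ac (nb-glue (p ∷ ps) (q ∷ qs) P Q p≢q))

    nb-minimal : ∀ {u ps k} → NonBacktracking (u ∷ ps) → Walk G u (end u ps) k → length ps ≤ k
    nb-minimal {u} {ps} P W with shortcut W
    ... | qs , Q , e , l = subst (_≤ _) (sym (nb-length-unique u ps qs P Q (sym e))) l

  Branching : Vertex → Set
  Branching v = ∃[ p ] ∃[ q ] p ≢ q × Adj G v p × Adj G v q

  extendˡ : ∀ {y ys} → NonBacktracking (y ∷ ys) → Branching y →
            ∃[ b ] NonBacktracking (b ∷ y ∷ ys)
  extendˡ {ys = []}    P (a , _ , _ , ya , _) = a , cons (adj-sym ya) tt P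
  extendˡ {ys = s ∷ _} P (a , b , a≢b , ya , yb) with a ≟ s
  ... | yes refl = b , cons (adj-sym yb) (a≢b ∘ sym) P
  ... | no a≢s   = a , cons (adj-sym ya) a≢s P

  extendʳ : ∀ {x ys} → NonBacktracking (x ∷ ys) → Branching (end x ys) →
            ∃[ b ] NonBacktracking (x ∷ ys ++ [ b ])
  extendʳ (single x) (a , _ , _ , xa , _) = a , cons xa tt (single a)
  extendʳ {x} (cons {ys = []} xy _ _) (a , b , a≢b , ya , yb) with a ≟ x
  ... | yes refl = b , cons xy a≢b (cons yb tt (single b))
  ... | no a≢x   = a , cons xy (a≢x ∘ sym) (cons ya tt (single a))
  extendʳ (cons {ys = _ ∷ _} xy nr P) br with extendʳ P br
  ... | b , Q = b , cons xy nr Q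

  branching-ends⇒distantPair : Acyclic G → ∀ {x ys} → NonBacktracking (x ∷ ys) →
                               Branching x → Branching (end x ys) → DistantPair (2 +ℕ length ys)
  branching-ends⇒distantPair ac {x} {ys} P bx be with extendʳ P be
  ... | b , Q with extendˡ Q bx
  ... | a , R = a , b , λ k W →
    subst (_≤ k) (cong suc (trans (length-++ ys) (+-comm (length ys) 1)))
          (nb-minimal ac R (subst (λ v → Walk G a v k) (sym (end-++ x ys b)) W))

-- Signed degrees and the lower bound

drop-nonpositive : ∀ {a b} s → a ≤ℤ + 0 → b ≤ℤ a +ℤ s → b ≤ℤ s
drop-nonpositive {a} s a≤0 b≤a+s =
  ≤ℤ-trans b≤a+s (subst (a +ℤ s ≤ℤ_) (+ℤ-identityˡ s) (+-monoˡ-≤ s a≤0))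

sum≥1⇒edge : ∀ {k} (e : Fin k → Maybe Sign) → + 1 ≤ℤ sumFin (contrib ∘ e) →
             ∃[ i ] ∃[ s ] e i ≡ just s
sum≥1⇒edge {zero}  e (+≤+ ())
sum≥1⇒edge {suc k} e 1≤Σ with e zero in e₀
... | just s  = zero , s , e₀
... | nothing with sum≥1⇒edge (e ∘ suc) (drop-nonpositive _ (+≤+ z≤n) 1≤Σ)
...   | i , eᵢ = suc i , eᵢ

TwoEdges : ∀ {k} → (Fin k → Maybe Sign) → Set
TwoEdges e = ∃[ i ] ∃[ j ] i ≢ j × (∃[ s ] e i ≡ just s) × (∃[ s ] e j ≡ just s)

two-edges-suc : ∀ {k} {e : Fin (suc k) → Maybe Sign} → TwoEdges (e ∘ suc) → TwoEdges e
two-edges-suc (i , j , i≢j , eᵢ , eⱼ) = suc i , suc j , i≢j ∘ suc-injective , eᵢ , eⱼ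

sum≥2⇒two-edges : ∀ {k} (e : Fin k → Maybe Sign) → + 2 ≤ℤ sumFin (contrib ∘ e) → TwoEdges e
sum≥2⇒two-edges {zero}  e (+≤+ ())
sum≥2⇒two-edges {suc k} e 2≤Σ with e zero in e₀
... | just pos with sum≥1⇒edge (e ∘ suc) (subst (+ 1 ≤ℤ_) (pred-suc _) (pred-mono 2≤Σ))
...   | j , eⱼ = zero , suc j , (λ ()) , (pos , e₀) , eⱼ
sum≥2⇒two-edges {suc k} e 2≤Σ | just neg =
  two-edges-suc (sum≥2⇒two-edges (e ∘ suc) (drop-nonpositive _ -≤+ 2≤Σ))
sum≥2⇒two-edges {suc k} e 2≤Σ | nothing =
  two-edges-suc (sum≥2⇒two-edges (e ∘ suc) (drop-nonpositive _ (+≤+ z≤n) 2≤Σ))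

sdeg≥2⇒branching : ∀ T v → + 2 ≤ℤ sdeg T v → Paths.Branching (graph T) v
sdeg≥2⇒branching T v = sum≥2⇒two-edges (edge (graph T) v)

module RealizingTree {n} (x : Fin n → ℤ) (x>1 : ∀ i → + 1 <ℤ x i)
                     (T : SignedTree) (real : Realizes T (DSet x)) where
  open Paths (graph T)

  vertexOf : Fin n → Vertex
  vertexOf i = proj₁ (proj₂ real (x i) (inj₂ (i , refl)))

  sdeg-vertexOf : ∀ i → sdeg T (vertexOf i) ≡ x i
  sdeg-vertexOf i = proj₂ (proj₂ real (x i) (inj₂ (i , refl)))

  vertexOf-injective : Injective _≡_ _≡_ x → ∀ {i j} → i ≢ j → vertexOf i ≢ vertexOf j
  vertexOf-injective inj i≢j vᵢ≡vⱼ =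
    i≢j (inj (trans (sym (sdeg-vertexOf _)) (trans (cong (sdeg T) vᵢ≡vⱼ) (sdeg-vertexOf _))))

  branching : ∀ i → Branching (vertexOf i)
  branching i = sdeg≥2⇒branching T (vertexOf i)
    (subst (+ 2 ≤ℤ_) (sym (sdeg-vertexOf i)) (i<j⇒suc[i]≤j (x>1 i)))

  path : ∀ i j → ∃[ ys ] NonBacktracking (vertexOf i ∷ ys) × end (vertexOf i) ys ≡ vertexOf j
  path i j with shortcut (proj₂ (connected T (vertexOf i) (vertexOf j)))
  ... | ys , P , e , _ = ys , P , e

  distantPair-along : ∀ i j {ys} → NonBacktracking (vertexOf i ∷ ys) →
                      end (vertexOf i) ys ≡ vertexOf j → DistantPair (2 +ℕ length ys)
  distantPair-along i j P e =
    branching-ends⇒distantPair (acyclic T) P (branching i) (subst Branching (sym e) (branching j))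

  distantPair₂ : Fin n → DistantPair 2
  distantPair₂ i = distantPair-along i i (single (vertexOf i)) refl

  distantPair₃ : Injective _≡_ _≡_ x → ∀ {i j} → i ≢ j → DistantPair 3
  distantPair₃ inj {i} {j} i≢j with path i j
  ... | []    , _ , e = ⊥-elim (vertexOf-injective inj i≢j e)
  ... | _ ∷ _ , P , e = distantPair-weaken (+-monoʳ-≤ 2 (s≤s z≤n)) (distantPair-along i j P e)

  distantPair₄ : Injective _≡_ _≡_ x → ∀ {i j l} → i ≢ j → i ≢ l → j ≢ l → DistantPair 4
  distantPair₄ inj {i} {j} {l} i≢j i≢l j≢l with path i j | path i l
  ... | [] , _ , e | _ = ⊥-elim (vertexOf-injective inj i≢j e)
  ... | _ | [] , _ , e = ⊥-elim (vertexOf-injective inj i≢l e)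
  ... | _ ∷ _ ∷ _ , P , e | _ =
    distantPair-weaken (+-monoʳ-≤ 2 (s≤s (s≤s z≤n))) (distantPair-along i j P e)
  ... | _ | _ ∷ _ ∷ _ , P , e =
    distantPair-weaken (+-monoʳ-≤ 2 (s≤s (s≤s z≤n))) (distantPair-along i l P e)
  ... | _ ∷ [] , cons a _ _ , refl | _ ∷ [] , cons b _ _ , refl =
    distantPair-along j l (cons (adj-sym a) (vertexOf-injective inj j≢l) (cons b tt (single _))) refl

diamSet-intro : ∀ {D d} → (∀ T → Realizes T D → Paths.DistantPair (graph T) d) →
                (T : SignedTree) → Realizes T D → (∀ u v → DistLe T u v d) → DiamSet D d
diamSet-intro distant T real close = (T , real , close , distant T real) , minimal
  where
    minimal : ∀ T′ d′ → Realizes T′ _ → HasDiam T′ d′ → _ ≤ d′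
    minimal T′ d′ real′ (close′ , _) with distant T′ real′
    ... | u , v , far with close′ u v
    ... | k , k≤d′ , W = ≤-trans (far k W) k≤d′

-- Two-level trees

sumFin-cong : ∀ {k} {f g : Fin k → ℤ} → (∀ i → f i ≡ g i) → sumFin f ≡ sumFin g
sumFin-cong {zero}  f≗g = refl
sumFin-cong {suc k} f≗g = cong₂ _+ℤ_ (f≗g zero) (sumFin-cong (f≗g ∘ suc))

sumFin-zeros : ∀ {k} (f : Fin k → ℤ) → (∀ i → f i ≡ + 0) → sumFin f ≡ + 0
sumFin-zeros {k} f f≗0 = trans (sumFin-cong f≗0) (zeros k)
  where
    zeros : ∀ k → sumFin {k} (λ _ → + 0) ≡ + 0
    zeros zero    = refl
    zeros (suc k) = cong (+ 0 +ℤ_) (zeros k)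

sumFin-ones : ∀ k → sumFin {k} (λ _ → + 1) ≡ + k
sumFin-ones zero    = refl
sumFin-ones (suc k) = cong (+ 1 +ℤ_) (sumFin-ones k)

sumFin-minusOnes : ∀ k → sumFin {k} (λ _ → -[1+ 0 ]) ≡ - + k
sumFin-minusOnes zero          = refl
sumFin-minusOnes (suc zero)    = refl
sumFin-minusOnes (suc (suc k)) = cong (-[1+ 0 ] +ℤ_) (sumFin-minusOnes (suc k))

sumFin-+ : ∀ a b (f : Fin (a +ℕ b) → ℤ) →
           sumFin f ≡ sumFin (f ∘ (_↑ˡ b)) +ℤ sumFin (f ∘ (a ↑ʳ_))
sumFin-+ zero    b f = sym (+ℤ-identityˡ _)
sumFin-+ (suc a) b f =
  trans (cong (f zero +ℤ_) (sumFin-+ a b (f ∘ suc))) (sym (+ℤ-assoc (f zero) _ _))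

edgeIfEqual : ∀ {k} → Fin k → Fin k → Maybe Sign
edgeIfEqual a b = if does (a ≟ b) then just pos else nothing

edgeIfEqual-just : ∀ {k} {a b : Fin k} {s} → edgeIfEqual a b ≡ just s → a ≡ b
edgeIfEqual-just {a = a} {b} e with a ≟ b
edgeIfEqual-just _  | yes a≡b = a≡b
edgeIfEqual-just () | no _

edgeIfEqual-refl : ∀ {k} (a : Fin k) → edgeIfEqual a a ≡ just pos
edgeIfEqual-refl a with a ≟ a
... | yes _  = refl
... | no a≢a = ⊥-elim (a≢a refl)

edgeIfEqual-sum : ∀ {k} (a : Fin k) → sumFin (contrib ∘ edgeIfEqual a) ≡ + 1
edgeIfEqual-sum {suc k} zero =
  cong (+ 1 +ℤ_) (sumFin-zeros (contrib ∘ edgeIfEqual {suc k} zero ∘ suc) (λ _ → refl))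
edgeIfEqual-sum (suc a)      = trans (+ℤ-identityˡ _) (edgeIfEqual-sum a)

total : ∀ {k} → (Fin k → ℕ) → ℕ
total {zero}  c = 0
total {suc k} c = c zero +ℕ total (c ∘ suc)

parent : ∀ {k} (c : Fin k → ℕ) → Fin (total c) → Fin k
parent {suc k} c ℓ = [ (λ _ → zero) , suc ∘ parent (c ∘ suc) ]′ (splitAt (c zero) ℓ)

parent-↑ˡ : ∀ {k} (c : Fin (suc k) → ℕ) j → parent c (j ↑ˡ total (c ∘ suc)) ≡ zero
parent-↑ˡ c j rewrite splitAt-↑ˡ (c zero) j (total (c ∘ suc)) = refl

parent-↑ʳ : ∀ {k} (c : Fin (suc k) → ℕ) ℓ → parent c (c zero ↑ʳ ℓ) ≡ suc (parent (c ∘ suc) ℓ)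
parent-↑ʳ c ℓ rewrite splitAt-↑ʳ (c zero) (total (c ∘ suc)) ℓ = refl

sumFin-parent : ∀ {k} (c : Fin (suc k) → ℕ) (g : Fin (suc k) → ℤ) →
                sumFin (g ∘ parent c) ≡
                sumFin {c zero} (λ _ → g zero) +ℤ sumFin (g ∘ suc ∘ parent (c ∘ suc))
sumFin-parent c g = trans (sumFin-+ (c zero) _ (g ∘ parent c))
  (cong₂ _+ℤ_ (sumFin-cong (cong g ∘ parent-↑ˡ c)) (sumFin-cong (cong g ∘ parent-↑ʳ c)))

parent-count : ∀ {k} (c : Fin k → ℕ) a →
               sumFin (λ ℓ → contrib (edgeIfEqual (parent c ℓ) a)) ≡ + c a
parent-count {suc k} c zero = begin
  sumFin (λ ℓ → contrib (edgeIfEqual (parent c ℓ) zero))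
    ≡⟨ sumFin-parent c (λ b → contrib (edgeIfEqual b zero)) ⟩
  sumFin {c zero} (λ _ → + 1) +ℤ sumFin {total (c ∘ suc)} (λ _ → + 0)
    ≡⟨ cong₂ _+ℤ_ (sumFin-ones (c zero)) (sumFin-zeros {total (c ∘ suc)} _ (λ _ → refl)) ⟩
  + c zero +ℤ + 0
    ≡⟨ +ℤ-identityʳ _ ⟩
  + c zero ∎
parent-count {suc k} c (suc a) = begin
  sumFin (λ ℓ → contrib (edgeIfEqual (parent c ℓ) (suc a)))
    ≡⟨ sumFin-parent c (λ b → contrib (edgeIfEqual b (suc a))) ⟩
  sumFin {c zero} (λ _ → + 0) +ℤ sumFin (λ ℓ → contrib (edgeIfEqual (parent (c ∘ suc) ℓ) a))
    ≡⟨ cong₂ _+ℤ_ (sumFin-zeros {c zero} _ (λ _ → refl)) (parent-count (c ∘ suc) a) ⟩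
  + 0 +ℤ + c (suc a)
    ≡⟨ +ℤ-identityˡ _ ⟩
  + c (suc a) ∎

-- The root inner zero is joined to the child inner (suc i) by an edge of sign σ i, and each
-- inner vertex a carries c a pendant leaves joined by positive edges; parent c numbers the
-- leaves consecutively.

pattern inner a = inj₁ a
pattern leaf ℓ  = inj₂ ℓ

module TwoLevelTree (p : ℕ) (σ : Fin p → Sign) (c : Fin (suc p) → ℕ) where

  Node : Set
  Node = Fin (suc p) ⊎ Fin (total c)

  root : Node
  root = inner zero

  innerLink : Fin (suc p) → Fin (suc p) → Maybe Sign
  innerLink zero    zero    = nothing
  innerLink zero    (suc i) = just (σ i)
  innerLink (suc i) zero    = just (σ i)
  innerLink (suc _) (suc _) = nothing

  link : Node → Node → Maybe Sign
  link (inner a) (inner b) = innerLink a b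
  link (inner a) (leaf ℓ)  = edgeIfEqual (parent c ℓ) a
  link (leaf ℓ)  (inner a) = edgeIfEqual (parent c ℓ) a
  link (leaf _)  (leaf _)  = nothing

  link-sym : ∀ k k′ → link k k′ ≡ link k′ k
  link-sym (inner zero)    (inner zero)    = refl
  link-sym (inner zero)    (inner (suc _)) = refl
  link-sym (inner (suc _)) (inner zero)    = refl
  link-sym (inner (suc _)) (inner (suc _)) = refl
  link-sym (inner _)       (leaf _)        = refl
  link-sym (leaf _)        (inner _)       = refl
  link-sym (leaf _)        (leaf _)        = refl

  link-irrefl : ∀ k → link k k ≡ nothing
  link-irrefl (inner zero)    = refl
  link-irrefl (inner (suc _)) = refl
  link-irrefl (leaf _)        = refl

  leaf-link : ∀ {ℓ k s} → link (leaf ℓ) k ≡ just s → k ≡ inner (parent c ℓ)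
  leaf-link {k = inner _} e = cong inner (sym (edgeIfEqual-just e))

  child-link : ∀ {i a s} → link (inner (suc i)) (inner a) ≡ just s → a ≡ zero
  child-link {a = zero} _ = refl

  node : Fin (suc p +ℕ total c) → Node
  node = splitAt (suc p)

  vertex : Node → Fin (suc p +ℕ total c)
  vertex = join (suc p) (total c)

  node-vertex : ∀ k → node (vertex k) ≡ k
  node-vertex = splitAt-join (suc p) (total c)

  vertex-node : ∀ v → vertex (node v) ≡ v
  vertex-node = join-splitAt (suc p) (total c)

  node-injective : ∀ {u v} → node u ≡ node v → u ≡ v
  node-injective {u} {v} e = trans (sym (vertex-node u)) (trans (cong vertex e) (vertex-node v))

  graphᵀ : SignedGraph (suc p +ℕ total c)
  graphᵀ = record
    { edge   = λ u w → link (node u) (node w)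
    ; symm   = λ u w → link-sym (node u) (node w)
    ; irrefl = link-irrefl ∘ node
    }

  open Paths graphᵀ

  link⇒adj : ∀ {k k′ s} → link k k′ ≡ just s → Adj graphᵀ (vertex k) (vertex k′)
  link⇒adj {k} {k′} {s} e =
    s , subst₂ (λ z z′ → link z z′ ≡ just s) (sym (node-vertex k)) (sym (node-vertex k′)) e

  innerDepth : Fin (suc p) → ℕ
  innerDepth zero    = 0
  innerDepth (suc _) = 1

  depth : Node → ℕ
  depth (inner a) = innerDepth a
  depth (leaf ℓ)  = suc (innerDepth (parent c ℓ))

  inner-to-root : ∀ a → Walk graphᵀ (vertex (inner a)) (vertex root) (innerDepth a)
  inner-to-root zero    = here
  inner-to-root (suc i) = step (link⇒adj {inner (suc i)} {root} refl) here

  walk-to-root : ∀ k → Walk graphᵀ (vertex k) (vertex root) (depth k)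
  walk-to-root (inner a) = inner-to-root a
  walk-to-root (leaf ℓ)  = step (link⇒adj {leaf ℓ} {inner (parent c ℓ)} (edgeIfEqual-refl (parent c ℓ)))
                                (inner-to-root (parent c ℓ))

  walk-via-root : ∀ k k′ → Walk graphᵀ (vertex k) (vertex k′) (depth k +ℕ depth k′)
  walk-via-root k k′ = walk-to-root k ++ʷ reverseʷ (walk-to-root k′)

  sibling-walk : ∀ {ℓ ℓ′} → parent c ℓ ≡ parent c ℓ′ →
                 Walk graphᵀ (vertex (leaf ℓ)) (vertex (leaf ℓ′)) 2
  sibling-walk {ℓ} {ℓ′} e = step {w = vertex (inner a)} (link⇒adj {leaf ℓ} {inner a} ℓ-a)
                                 (step (link⇒adj {inner a} {leaf ℓ′} (edgeIfEqual-refl a)) here)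
    where
      a = parent c ℓ′
      ℓ-a : edgeIfEqual (parent c ℓ) a ≡ just pos
      ℓ-a = subst (λ b → edgeIfEqual b a ≡ just pos) (sym e) (edgeIfEqual-refl a)

  -- A leaf has a single neighbour, so no cycle passes through a leaf; the only inner neighbour
  -- of a child is the root, so every vertex of a cycle would be the root.
  acyclicᵀ : Acyclic graphᵀ
  acyclicᵀ (j , cv , cv-injective , chain , close) =
    0≢1+n (cv-injective (node-injective (trans (on-root zero) (sym (on-root (suc zero))))))
    where
      neighbours : ∀ k → ∃[ k₁ ] ∃[ k₂ ] node (cv k₁) ≢ node (cv k₂)
                   × (∃[ s ] link (node (cv k)) (node (cv k₁)) ≡ just s)
                   × (∃[ s ] link (node (cv k)) (node (cv k₂)) ≡ just s)
      neighbours k with cycle-neighbours cv chain close k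
      ... | k₁ , k₂ , k₁≢k₂ , a₁ , a₂ =
        k₁ , k₂ , k₁≢k₂ ∘ cv-injective ∘ node-injective , a₁ , a₂

      on-inner : ∀ k → ∃[ a ] node (cv k) ≡ inner a
      on-inner k with node (cv k) | neighbours k
      ... | inner a | _ = a , refl
      ... | leaf ℓ  | _ , _ , ≢ , (_ , a₁) , (_ , a₂) =
        ⊥-elim (≢ (trans (leaf-link a₁) (sym (leaf-link a₂))))

      child-neighbour : ∀ {i k s} → link (inner (suc i)) (node (cv k)) ≡ just s → node (cv k) ≡ root
      child-neighbour {k = k} e with node (cv k) | on-inner k
      ... | _ | _ , refl = cong inner (child-link e)

      on-root : ∀ k → node (cv k) ≡ root
      on-root k with node (cv k) | on-inner k | neighbours k
      ... | _ | zero  , refl | _ = refl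
      ... | _ | suc i , refl | _ , _ , ≢ , (_ , a₁) , (_ , a₂) =
        ⊥-elim (≢ (trans (child-neighbour a₁) (sym (child-neighbour a₂))))

  walk-between : ∀ u v → Walk graphᵀ u v (depth (node u) +ℕ depth (node v))
  walk-between u v = subst₂ (λ u′ v′ → Walk graphᵀ u′ v′ (depth (node u) +ℕ depth (node v)))
                            (vertex-node u) (vertex-node v) (walk-via-root (node u) (node v))

  tree : SignedTree
  tree = record
    { size      = p +ℕ total c
    ; graph     = graphᵀ
    ; connected = λ u v → _ , walk-between u v
    ; acyclic   = acyclicᵀ
    }

  distances-intro : ∀ {d} → (∀ k k′ → ∃[ j ] j ≤ d × Walk graphᵀ (vertex k) (vertex k′) j) →
                    ∀ u v → DistLe tree u v d
  distances-intro close u v with close (node u) (node v)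
  ... | j , j≤d , W =
    j , j≤d , subst₂ (λ u′ v′ → Walk graphᵀ u′ v′ j) (vertex-node u) (vertex-node v) W

  sdeg-vertex : ∀ k → sdeg tree (vertex k) ≡
                sumFin (λ a → contrib (link k (inner a))) +ℤ sumFin (λ ℓ → contrib (link k (leaf ℓ)))
  sdeg-vertex k = trans (sumFin-+ (suc p) (total c) (λ w → contrib (link (node (vertex k)) (node w))))
    (cong₂ _+ℤ_ (sumFin-cong (contrib-link ∘ inner)) (sumFin-cong (contrib-link ∘ leaf)))
    where
      contrib-link : ∀ k′ → contrib (link (node (vertex k)) (node (vertex k′))) ≡ contrib (link k k′)
      contrib-link k′ = cong₂ (λ z z′ → contrib (link z z′)) (node-vertex k) (node-vertex k′)

  sdeg-leaf : ∀ ℓ → sdeg tree (vertex (leaf ℓ)) ≡ + 1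
  sdeg-leaf ℓ = trans (sdeg-vertex (leaf ℓ))
    (cong₂ _+ℤ_ (edgeIfEqual-sum (parent c ℓ)) (sumFin-zeros {total c} _ (λ _ → refl)))

  sdeg-root : sdeg tree (vertex root) ≡ sumFin (contrib ∘ just ∘ σ) +ℤ + c zero
  sdeg-root = trans (sdeg-vertex root)
    (cong₂ _+ℤ_ (+ℤ-identityˡ (sumFin (contrib ∘ just ∘ σ))) (parent-count c zero))

  sdeg-child : ∀ i → sdeg tree (vertex (inner (suc i))) ≡ contrib (just (σ i)) +ℤ + c (suc i)
  sdeg-child i = trans (sdeg-vertex (inner (suc i)))
    (cong₂ _+ℤ_ (trans (cong (contrib (just (σ i)) +ℤ_) (sumFin-zeros {p} _ (λ _ → refl)))
                       (+ℤ-identityʳ (contrib (just (σ i)))))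
                (parent-count c (suc i)))

  innerDepth≤1 : ∀ a → innerDepth a ≤ 1
  innerDepth≤1 zero    = z≤n
  innerDepth≤1 (suc _) = s≤s z≤n

  depth≤2 : ∀ k → depth k ≤ 2
  depth≤2 (inner a) = ≤-trans (innerDepth≤1 a) (s≤s z≤n)
  depth≤2 (leaf ℓ)  = s≤s (innerDepth≤1 (parent c ℓ))

  via-root : ∀ {d} k k′ → depth k +ℕ depth k′ ≤ d →
             ∃[ j ] j ≤ d × Walk graphᵀ (vertex k) (vertex k′) j
  via-root k k′ ≤d = _ , ≤d , walk-via-root k k′

  depth-bounded : ∀ {r} → (∀ k → depth k ≤ r) → ∀ u v → DistLe tree u v (r +ℕ r)
  depth-bounded ≤r = distances-intro λ k k′ → via-root k k′ (+-mono-≤ (≤r k) (≤r k′))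

  realizes-intro : ∀ {D : ℤ → Set} → (∀ k → D (sdeg tree (vertex k))) →
                   (∀ z → D z → ∃[ k ] sdeg tree (vertex k) ≡ z) → Realizes tree D
  realizes-intro {D} sdeg∈D attained =
    (λ v → subst (D ∘ sdeg tree) (vertex-node v) (sdeg∈D (node v))) ,
    (λ z z∈D → map vertex id (attained z z∈D))

-- The extremal trees

>1⇒2+ : ∀ {z} → + 1 <ℤ z → ∃[ m ] z ≡ + suc (suc m)
>1⇒2+ (+<+ (s≤s (s≤s {n = m} _))) = m , refl

-n+[1+n]≡1 : ∀ n → - + n +ℤ + suc n ≡ + 1
-n+[1+n]≡1 n = begin
  - + n +ℤ + suc n  ≡⟨ +ℤ-comm (- + n) (+ suc n) ⟩
  + suc n +ℤ - + n  ≡⟨ m-n≡m⊖n (suc n) n ⟩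
  suc n ⊖ n         ≡⟨ ⊖-≥ (n≤1+n n) ⟩
  + (suc n ∸ n)     ≡⟨ cong +_ (m+n∸n≡m 1 n) ⟩
  + 1               ∎

module Star (x : Fin 1 → ℤ) (x>1 : ∀ i → + 1 <ℤ x i) where
  m : ℕ
  m = proj₁ (>1⇒2+ (x>1 zero))

  c : Fin 1 → ℕ
  c zero = suc (suc m)

  open TwoLevelTree 0 (λ ()) c

  sdeg-root≡x : sdeg tree (vertex root) ≡ x zero
  sdeg-root≡x = trans sdeg-root (sym (proj₂ (>1⇒2+ (x>1 zero))))

  realizes : Realizes tree (DSet x)
  realizes = realizes-intro sdeg∈D attained
    where
      sdeg∈D : ∀ k → DSet x (sdeg tree (vertex k))
      sdeg∈D (inner zero) = inj₂ (zero , sdeg-root≡x)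
      sdeg∈D (leaf ℓ)     = inj₁ (sdeg-leaf ℓ)
      attained : ∀ z → DSet x z → ∃[ k ] sdeg tree (vertex k) ≡ z
      attained _ (inj₁ refl)          = leaf zero , sdeg-leaf zero
      attained _ (inj₂ (zero , refl)) = root , sdeg-root≡x

  depth≤1 : ∀ k → depth k ≤ 1
  depth≤1 (inner zero) = z≤n
  depth≤1 (leaf ℓ)     = s≤s (only-root (parent c ℓ))
    where
      only-root : ∀ a → innerDepth a ≤ 0
      only-root zero = z≤n

  diameter : DiamSet (DSet x) 2
  diameter = diamSet-intro (λ T real → RealizingTree.distantPair₂ x x>1 T real zero)
                           tree realizes (depth-bounded depth≤1)

module DoubleStar (x : Fin 2 → ℤ) (x>1 : ∀ i → + 1 <ℤ x i) where
  m : Fin 2 → ℕ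
  m i = proj₁ (>1⇒2+ (x>1 i))

  open TwoLevelTree 1 (λ _ → pos) (suc ∘ m)

  realizes : Realizes tree (DSet x)
  realizes = realizes-intro sdeg∈D attained
    where
      x≡ : ∀ i → + suc (suc (m i)) ≡ x i
      x≡ i = sym (proj₂ (>1⇒2+ (x>1 i)))
      sdeg∈D : ∀ k → DSet x (sdeg tree (vertex k))
      sdeg∈D (inner zero)       = inj₂ (zero , trans sdeg-root (x≡ zero))
      sdeg∈D (inner (suc zero)) = inj₂ (suc zero , trans (sdeg-child zero) (x≡ (suc zero)))
      sdeg∈D (leaf ℓ)           = inj₁ (sdeg-leaf ℓ)
      attained : ∀ z → DSet x z → ∃[ k ] sdeg tree (vertex k) ≡ z
      attained _ (inj₁ refl)              = leaf zero , sdeg-leaf zero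
      attained _ (inj₂ (zero , refl))     = root , trans sdeg-root (x≡ zero)
      attained _ (inj₂ (suc zero , refl)) = inner (suc zero) , trans (sdeg-child zero) (x≡ (suc zero))

  -- Only the leaves of the child lie at depth 2, and two of them are siblings.
  close : ∀ k k′ → ∃[ j ] j ≤ 3 × Walk graphᵀ (vertex k) (vertex k′) j
  close (inner a) k′       = via-root (inner a) k′ (+-mono-≤ (innerDepth≤1 a) (depth≤2 k′))
  close (leaf ℓ)  (inner a) = via-root (leaf ℓ) (inner a) (+-mono-≤ (depth≤2 (leaf ℓ)) (innerDepth≤1 a))
  close (leaf ℓ) (leaf ℓ′) with parent (suc ∘ m) ℓ in e | parent (suc ∘ m) ℓ′ in e′
  ... | zero     | _        = via-root (leaf ℓ) (leaf ℓ′)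
    (subst (λ a → suc (innerDepth a) +ℕ depth (leaf ℓ′) ≤ 3) (sym e)
           (s≤s (depth≤2 (leaf ℓ′))))
  ... | suc zero | zero     = via-root (leaf ℓ) (leaf ℓ′)
    (subst (λ a → depth (leaf ℓ) +ℕ suc (innerDepth a) ≤ 3) (sym e′)
           (+-mono-≤ (depth≤2 (leaf ℓ)) ≤-refl))
  ... | suc zero | suc zero = 2 , s≤s (s≤s z≤n) , sibling-walk (trans e (sym e′))

  diameter : Injective _≡_ _≡_ x → DiamSet (DSet x) 3
  diameter inj =
    diamSet-intro (λ T real → RealizingTree.distantPair₃ x x>1 T real inj {zero} {suc zero} (λ ()))
                  tree realizes (distances-intro close)

-- All n root edges are negative: with n + 1 leaves the root has signed degree 1, and the
-- child for x i needs x i + 1 leaves.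
module Spider {k} (x : Fin (suc (suc (suc k))) → ℤ) (x>1 : ∀ i → + 1 <ℤ x i) where
  n : ℕ
  n = suc (suc (suc k))

  m : Fin n → ℕ
  m i = proj₁ (>1⇒2+ (x>1 i))

  c : Fin (suc n) → ℕ
  c zero    = suc n
  c (suc i) = suc (suc (suc (m i)))

  open TwoLevelTree n (λ _ → neg) c

  sdeg-root≡1 : sdeg tree (vertex root) ≡ + 1
  sdeg-root≡1 = trans sdeg-root (trans (cong (_+ℤ + suc n) (sumFin-minusOnes n)) (-n+[1+n]≡1 n))

  realizes : Realizes tree (DSet x)
  realizes = realizes-intro sdeg∈D attained
    where
      sdeg-child≡x : ∀ i → sdeg tree (vertex (inner (suc i))) ≡ x i
      sdeg-child≡x i = trans (sdeg-child i) (sym (proj₂ (>1⇒2+ (x>1 i))))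
      sdeg∈D : ∀ k → DSet x (sdeg tree (vertex k))
      sdeg∈D (inner zero)    = inj₁ sdeg-root≡1
      sdeg∈D (inner (suc i)) = inj₂ (i , sdeg-child≡x i)
      sdeg∈D (leaf ℓ)        = inj₁ (sdeg-leaf ℓ)
      attained : ∀ z → DSet x z → ∃[ k ] sdeg tree (vertex k) ≡ z
      attained _ (inj₁ refl)       = root , sdeg-root≡1
      attained _ (inj₂ (i , refl)) = inner (suc i) , sdeg-child≡x i

  diameter : Injective _≡_ _≡_ x → DiamSet (DSet x) 4
  diameter inj = diamSet-intro
    (λ T real → RealizingTree.distantPair₄ x x>1 T real inj {zero} {suc zero} {suc (suc zero)}
                                           (λ ()) (λ ()) (λ ()))
    tree realizes (depth-bounded depth≤2)

mainTheorem2 : (n : ℕ) → 1 ≤ n → (x : Fin n → ℤ) → Injective _≡_ _≡_ x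
    → (∀ i → + 1 <ℤ x i)
    → (n ≡ 1 → DiamSet (DSet x) 2)
      × (n ≡ 2 → DiamSet (DSet x) 3)
      × (2 < n → DiamSet (DSet x) 4)
-- The hypothesis 1 ≤ n is not needed: each case fixes n.
mainTheorem2 n _ x x-injective x>1 = one x x>1 , two x x-injective x>1 , many x x-injective x>1
  where
    one : ∀ {n} (x : Fin n → ℤ) → (∀ i → + 1 <ℤ x i) → n ≡ 1 → DiamSet (DSet x) 2
    one x x>1 refl = Star.diameter x x>1

    two : ∀ {n} (x : Fin n → ℤ) → Injective _≡_ _≡_ x → (∀ i → + 1 <ℤ x i) →
          n ≡ 2 → DiamSet (DSet x) 3
    two x inj x>1 refl = DoubleStar.diameter x x>1 inj

    many : ∀ {n} (x : Fin n → ℤ) → Injective _≡_ _≡_ x → (∀ i → + 1 <ℤ x i) →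
           2 < n → DiamSet (DSet x) 4
    many x inj x>1 (s≤s (s≤s (s≤s _))) = Spider.diameter x x>1 inj
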